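{- There exists a structure of cardinality $1$ that is a model of $(\Sigma^\sharp \setminus \{B3\}) \cup \{\neg B3\}$, where $\Sigma^\sharp$ is the axiom system described in the context.
   Context: Work in classical one-sorted first-order logic with equality, in the language with three constant symbols $a_0, a_1, a_2$, a ternary relation symbol $L$ (collinearity) and a ternary function symbol $\tau$. Write $\sigma(a,b)$ as an abbreviation for $\tau(b,a,a)$. The axioms below are understood as universally closed: A3: $a \ne b \wedge L(a,b,c) \wedge L(a,b,d) \rightarrow L(a,c,d)$; B1: $L(a,b,c) \rightarrow L(b,a,c)$; B2: $\tau(a,b,c) = \tau(a,c,b)$; B3: $L(a,b,\sigma(a,b))$; B4: $L(a,b,c) \rightarrow L(x, \tau(a,b,x), \tau(a,c,x))$; B6: $\tau(a,b,x) = \tau(c, \tau(a,b,x), x)$; B7: $\neg L(a_0,a_1,a_2)$; B8: $\sigma(a,b) = b \rightarrow a = b$. $\Sigma^\sharp$ is the set $\{A3,B1,B2,B3,B4,B6,B7,B8\}$. -}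

module Defs where

open import Data.Product using (Σ; ∃; _×_)
open import Data.Fin using (Fin)
open import Function.Bundles using (_↔_)
open import Relation.Nullary using (¬_)
open import Relation.Binary.PropositionalEquality using (_≡_; _≢_)

record Structure : Set₁ where
  field
    Carrier : Set
    a₀ a₁ a₂ : Carrier
    L : Carrier → Carrier → Carrier → Set
    τ : Carrier → Carrier → Carrier → Carrier

  σ : Carrier → Carrier → Carrier
  σ a b = τ b a a

module _ (M : Structure) where
  open Structure M

  AxA3 : Set
  AxA3 = ∀ a b c d → a ≢ b → L a b c → L a b d → L a c d

  AxB1 : Set
  AxB1 = ∀ a b c → L a b c → L b a c

  AxB2 : Set
  AxB2 = ∀ a b c → τ a b c ≡ τ a c b

  AxB3 : Set
  AxB3 = ∀ a b → L a b (σ a b)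

  AxB4 : Set
  AxB4 = ∀ a b c x → L a b c → L x (τ a b x) (τ a c x)

  AxB6 : Set
  AxB6 = ∀ a b c x → τ a b x ≡ τ c (τ a b x) x

  AxB7 : Set
  AxB7 = ¬ L a₀ a₁ a₂

  AxB8 : Set
  AxB8 = ∀ a b → σ a b ≡ b → a ≡ b

  ModelWithoutB3NegB3 : Set
  ModelWithoutB3NegB3 =
    AxA3 × AxB1 × AxB2 × (¬ AxB3) × AxB4 × AxB6 × AxB7 × AxB8

  HasCardinalityOne : Set
  HasCardinalityOne = Carrier ↔ Fin 1

-- In a one-point structure every term denotes the single point, so all the
-- equational axioms (B2, B6, B8) hold trivially. Interpreting L as the empty
-- relation makes the Horn axioms A3, B1, B4 vacuous and B7 true, while B3,
-- the only axiom asserting that some triple is collinear, fails.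
module Submission where

open import Defs
open import Data.Product using (Σ; _×_; _,_)
open import Data.Unit using (⊤; tt)
open import Data.Empty using (⊥)
open import Function.Properties.Inverse using (↔-sym)
open import Data.Fin.Properties using (1↔⊤)
open import Relation.Binary.PropositionalEquality using (refl)

point : Structure
point = record
  { Carrier = ⊤ ; a₀ = tt ; a₁ = tt ; a₂ = tt
  ; L = λ _ _ _ → ⊥ ; τ = λ _ _ _ → tt
  }

point-hasCardinalityOne : HasCardinalityOne point
point-hasCardinalityOne = ↔-sym 1↔⊤

point-⊨-ΣwithoutB3+¬B3 : ModelWithoutB3NegB3 point
point-⊨-ΣwithoutB3+¬B3 =
    (λ _ _ _ _ _ ())
  , (λ _ _ _ ())
  , (λ _ _ _ → refl)
  , (λ b3 → b3 tt tt)
  , (λ _ _ _ _ ())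
  , (λ _ _ _ _ → refl)
  , (λ ())
  , (λ _ _ _ → refl)

proposition6 : Σ Structure (λ M → HasCardinalityOne M × ModelWithoutB3NegB3 M)
proposition6 = point , point-hasCardinalityOne , point-⊨-ΣwithoutB3+¬B3
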